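{- Let $\Pi$ be a transformation that is confluent and isomorphism-invariant. Then the transformation $\Pi^*$ that applies $\Pi$ exhaustively (i.e. $\Pi^*(F)$ is the set of formulas $F^*$ with $F\xrightarrow{\Pi}^* F^*$) is symmetry-preserving.
   Context: Literals: each variable $v$ gives literals $v,\bar v$ with $\bar{\bar v}=v$. A CNF formula $F$ is a finite set of clauses, each a finite set of literals; $\mathrm{Var}(F)$ is the set of variables occurring in $F$ and $\mathrm{Lit}(F):=\mathrm{Var}(F)\cup\{\bar v:v\in\mathrm{Var}(F)\}$. Bijections of literals act on clauses and formulas elementwise. For a set of literals $L$ closed under negation, $\mathrm{Sym}_L(L)$ is the set of bijections $\varphi:L\to L$ with $\overline{\varphi(l)}=\varphi(\bar l)$ for all $l\in L$. A syntactic symmetry of $F$ is a $\varphi\in\mathrm{Sym}_L(\mathrm{Lit}(F))$ with $\varphi(F)=F$; these form the group $\mathrm{Aut}_{\mathrm{syn}}(F)$. For a permutation group $\Gamma$ on $\Omega$ and $\Omega'\subseteq\Omega$: the setwise stabilizer is $\Gamma_{\{\Omega'\}}:=\{\varphi\in\Gamma:\varphi(\Omega')=\Omega'\}$ and $\Gamma\downarrow_{\Omega'}:=\{\varphi|_{\Omega'}:\varphi\in\Gamma_{\{\Omega'\}}\}$. A transformation $\Pi$ assigns to each CNF formula $F$ a finite set $\Pi(F)$ of CNF formulas $F_i$ with $\mathrm{Var}(F_i)\subseteq\mathrm{Var}(F)$; write $F\xrightarrow{\Pi}F'$ if $F'\in\Pi(F)$, and $F\xrightarrow{\Pi}^*F^*$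 if $F^*$ is reached from $F$ by a finite sequence of applications of $\Pi$ with $\Pi(F^*)=\emptyset$ (it is assumed that all such sequences of rule applications are finite). $\Pi$ is confluent if for every $F$, any two $F^*_1,F^*_2$ with $F\xrightarrow{\Pi}^*F^*_1$ and $F\xrightarrow{\Pi}^*F^*_2$ satisfy $F^*_1=F^*_2$. $\Pi$ is isomorphism-invariant if for all formulas $F$, all finite sets $V$ of variables, all $\varphi\in\mathrm{Sym}_L(\mathrm{Lit}(F)\cup V\cup\{\bar v:v\in V\})$ and all $F'\in\Pi(F)$ we have $\varphi(F')\in\Pi(\varphi(F))$. A transformation $\Pi$ is symmetry-preserving if for all CNF formulas $F,F'$ with $F\xrightarrow{\Pi}F'$ both $\mathrm{Aut}_{\mathrm{syn}}(F)_{\{\mathrm{Lit}(F')\}}=\mathrm{Aut}_{\mathrm{syn}}(F)$ and $\mathrm{Aut}_{\mathrm{syn}}(F)\downarrow_{\mathrm{Lit}(F')}\subseteq\mathrm{Aut}_{\mathrm{syn}}(F')$ hold. -}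

module Defs where

open import Data.Nat using (ℕ)
open import Data.List using (List; []; map)
open import Data.List.Membership.Propositional using (_∈_)
open import Data.List.Relation.Unary.Any using (Any)
open import Data.Product using (Σ; ∃; _×_; _,_)
open import Data.Sum using (_⊎_)
open import Relation.Binary.PropositionalEquality using (_≡_)
open import Relation.Binary.Construct.Closure.ReflexiveTransitive using (Star)
open import Induction.WellFounded using (WellFounded)
open import Function using (flip)

data Lit : Set where
  pos : ℕ → Lit
  neg : ℕ → Lit

var : Lit → ℕ
var (pos v) = v
var (neg v) = v

bar : Lit → Lit
bar (pos v) = neg v
bar (neg v) = pos v

-- Clauses are finite sets of literals and formulas are finite sets of
-- clauses.  They are represented by lists, and all notions below are
-- taken up to *set* equality (order and multiplicity are irrelevant).

Clause : Set
Clause = List Lit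

Formula : Set
Formula = List Clause

_≈C_ : Clause → Clause → Set
C ≈C D = ∀ l → (l ∈ C → l ∈ D) × (l ∈ D → l ∈ C)

_∈F_ : Clause → Formula → Set
C ∈F F = Any (C ≈C_) F

_≈F_ : Formula → Formula → Set
F ≈F G = ∀ C → (C ∈F F → C ∈F G) × (C ∈F G → C ∈F F)

_∈FS_ : Formula → List Formula → Set
H ∈FS Hs = Any (H ≈F_) Hs

_≈FS_ : List Formula → List Formula → Set
Hs ≈FS Ks = ∀ H → (H ∈FS Hs → H ∈FS Ks) × (H ∈FS Ks → H ∈FS Hs)

_∈Var_ : ℕ → Formula → Set
v ∈Var F = ∃ λ C → C ∈ F × ∃ λ l → l ∈ C × var l ≡ v

_∈Lit_ : Lit → Formula → Set
l ∈Lit F = var l ∈Var F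

actC : (Lit → Lit) → Clause → Clause
actC φ C = map φ C

act : (Lit → Lit) → Formula → Formula
act φ F = map (actC φ) F

-- Sym_L(L) for a set L of literals closed under negation, given as a
-- predicate.  An element is represented by a function φ : Lit → Lit
-- whose values outside L are irrelevant; the conditions say that φ
-- restricted to L is a bijection L → L commuting with negation.

IsSymOn : (Lit → Set) → (Lit → Lit) → Set
IsSymOn L φ =
  (∀ l → L l → L (φ l))
  × (∀ l₁ l₂ → L l₁ → L l₂ → φ l₁ ≡ φ l₂ → l₁ ≡ l₂)
  × (∀ l → L l → Σ Lit λ l' → L l' × φ l' ≡ l)
  × (∀ l → L l → bar (φ l) ≡ φ (bar l))

IsSynSym : Formula → (Lit → Lit) → Set
IsSynSym F φ = IsSymOn (_∈Lit F) φ × (act φ F ≈F F)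

StabilizesLit : Formula → (Lit → Lit) → Set
StabilizesLit F' φ =
  (∀ l → l ∈Lit F' → φ l ∈Lit F')
  × (∀ l → l ∈Lit F' → Σ Lit λ l' → l' ∈Lit F' × φ l' ≡ l)

-- Transformations.  Π assigns to each formula a finite set (list) of
-- formulas; it is a function on formulas-as-sets, so it must respect
-- set equality; and Var(F_i) ⊆ Var(F).

record Transformation : Set where
  field
    Π    : Formula → List Formula
    resp : ∀ F G → F ≈F G → Π F ≈FS Π G
    vars : ∀ F F' → F' ∈FS Π F → ∀ v → v ∈Var F' → v ∈Var F

open Transformation public

Step : Transformation → Formula → Formula → Set
Step T F F' = F' ∈FS Π T F

Terminating : Transformation → Set
Terminating T = WellFounded (flip (Step T))

Exhaust : Transformation → Formula → Formula → Set
Exhaust T F F* =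
  Σ Formula λ G → Star (Step T) F G × (G ≈F F*) × (Π T G ≡ [])

Confluent : Transformation → Set
Confluent T = ∀ F F₁ F₂ → Exhaust T F F₁ → Exhaust T F F₂ → F₁ ≈F F₂

IsomorphismInvariant : Transformation → Set
IsomorphismInvariant T =
  ∀ (F : Formula) (V : List ℕ) (φ : Lit → Lit) →
  IsSymOn (λ l → l ∈Lit F ⊎ var l ∈ V) φ →
  ∀ F' → Step T F F' → Step T (act φ F) (act φ F')

-- Symmetry preservation, for a transformation given by its step
-- relation R (F --Π--> F' iff R F F'):
--   Aut_syn(F)_{Lit(F')} = Aut_syn(F)   and
--   Aut_syn(F)↓_{Lit(F')} ⊆ Aut_syn(F').
SymmetryPreserving : (Formula → Formula → Set) → Set
SymmetryPreserving R =
  ∀ F F' → R F F' →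
  ∀ φ → IsSynSym F φ → StabilizesLit F' φ × IsSynSym F' φ

-- Let F →* G with Π(G) = ∅ and G ≈ F*, and let φ be a syntactic symmetry
-- of F.  Isomorphism invariance carries the reduction to φ(F) →* φ(G), and,
-- applied to the inverse of φ, shows that φ(G) is again irreducible.  Since
-- φ(F) = F, the formula φ(F*) is also an exhaustive result from F, so
-- confluence gives φ(F*) = F*.  As Lit(F*) ⊆ Lit(F), the restriction of φ
-- to Lit(F*) is then a syntactic symmetry of F*.
module Submission where

open import Defs
open import Data.Nat using (ℕ)
open import Data.Nat.Properties using (_≟_)
open import Data.List using (List; []; _∷_; map; concatMap)
open import Data.List.Properties using (map-∘; map-id-local)
open import Data.List.Membership.Propositional using (_∈_; find; lose)
open import Data.List.Membership.Propositional.Properties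
  using (∈-map⁺; ∈-map⁻; ∈-concatMap⁺; ∈-concatMap⁻)
open import Data.List.Membership.DecPropositional _≟_ using (_∈?_)
open import Data.List.Relation.Unary.Any using (here)
open import Data.List.Relation.Unary.Any.Properties using (¬Any[])
import Data.List.Relation.Unary.All as All
open import Data.Product using (Σ; ∃; _×_; _,_; proj₁; proj₂)
open import Data.Sum using (_⊎_; inj₁; inj₂; [_,_]′)
open import Data.Empty using (⊥-elim)
open import Function using (_∘_)
open import Relation.Nullary using (¬_; yes; no; contradiction)
open import Relation.Nullary.Decidable using (map′)
open import Relation.Unary using (Decidable; _≐_)
open import Relation.Binary.PropositionalEquality
  using (_≡_; refl; sym; trans; cong; subst; module ≡-Reasoning)
open import Relation.Binary.Construct.Closure.ReflexiveTransitive using (Star; ε; _◅_)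

≈C-refl : ∀ {C} → C ≈C C
≈C-refl l = (λ l∈ → l∈) , (λ l∈ → l∈)

≈C-sym : ∀ {C D} → C ≈C D → D ≈C C
≈C-sym C≈D l = proj₂ (C≈D l) , proj₁ (C≈D l)

≈C-trans : ∀ {C D E} → C ≈C D → D ≈C E → C ≈C E
≈C-trans C≈D D≈E l = proj₁ (D≈E l) ∘ proj₁ (C≈D l) , proj₂ (C≈D l) ∘ proj₂ (D≈E l)

≈F-refl : ∀ {F} → F ≈F F
≈F-refl C = (λ C∈ → C∈) , (λ C∈ → C∈)

≈F-sym : ∀ {F G} → F ≈F G → G ≈F F
≈F-sym F≈G C = proj₂ (F≈G C) , proj₁ (F≈G C)

≈F-trans : ∀ {F G H} → F ≈F G → G ≈F H → F ≈F H
≈F-trans F≈G G≈H C = proj₁ (G≈H C) ∘ proj₁ (F≈G C) , proj₂ (F≈G C) ∘ proj₂ (G≈H C)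

actC-cong : ∀ φ {C D} → C ≈C D → actC φ C ≈C actC φ D
actC-cong φ {C} {D} C≈D l = image C≈D , image (≈C-sym C≈D)
  where
  image : ∀ {C D} → C ≈C D → l ∈ actC φ C → l ∈ actC φ D
  image C≈D l∈ with ∈-map⁻ φ l∈
  ... | k , k∈ , refl = ∈-map⁺ φ (proj₁ (C≈D k) k∈)

∈F-act⁻ : ∀ φ F {C} → C ∈F act φ F → ∃ λ D → D ∈ F × C ≈C actC φ D
∈F-act⁻ φ F C∈ with find C∈
... | E , E∈ , C≈E with ∈-map⁻ (actC φ) E∈
... | D , D∈ , refl = D , D∈ , C≈E

act-cong : ∀ φ {F G} → F ≈F G → act φ F ≈F act φ G
act-cong φ {F} {G} F≈G C = image F≈G , image (≈F-sym F≈G)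
  where
  image : ∀ {F G} → F ≈F G → C ∈F act φ F → C ∈F act φ G
  image {F} F≈G C∈ with ∈F-act⁻ φ F C∈
  ... | D , D∈ , C≈φD with find (proj₁ (F≈G D) (lose D∈ ≈C-refl))
  ... | D' , D'∈ , D≈D' = lose (∈-map⁺ (actC φ) D'∈) (≈C-trans C≈φD (actC-cong φ D≈D'))

act-inverse : ∀ ψ φ G → (∀ l → l ∈Lit G → ψ (φ l) ≡ l) → act ψ (act φ G) ≡ G
act-inverse ψ φ G ψφ≡id = begin
  map (actC ψ) (map (actC φ) G)  ≡⟨ map-∘ G ⟨
  map (actC ψ ∘ actC φ) G        ≡⟨ map-id-local (All.tabulate clause-fixed) ⟩
  G                              ∎
  where
  open ≡-Reasoning
  clause-fixed : ∀ {C} → C ∈ G → actC ψ (actC φ C) ≡ C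
  clause-fixed {C} C∈ = trans (sym (map-∘ C))
    (map-id-local (All.tabulate λ {l} l∈ → ψφ≡id l (C , C∈ , l , l∈ , refl)))

bar-involutive : ∀ l → bar (bar l) ≡ l
bar-involutive (pos v) = refl
bar-involutive (neg v) = refl

var-bar : ∀ l → var (bar l) ≡ var l
var-bar (pos v) = refl
var-bar (neg v) = refl

var-injective-up-to-bar : ∀ k l → var k ≡ var l → k ≡ l ⊎ k ≡ bar l
var-injective-up-to-bar (pos v) (pos .v) refl = inj₁ refl
var-injective-up-to-bar (pos v) (neg .v) refl = inj₂ refl
var-injective-up-to-bar (neg v) (pos .v) refl = inj₂ refl
var-injective-up-to-bar (neg v) (neg .v) refl = inj₁ refl

∈Lit-bar : ∀ {F} l → l ∈Lit F → bar l ∈Lit F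
∈Lit-bar (pos v) l∈ = l∈
∈Lit-bar (neg v) l∈ = l∈

_⊆Var_ : Formula → Formula → Set
G ⊆Var F = ∀ v → v ∈Var G → v ∈Var F

≈F⇒⊆Var : ∀ {F G} → F ≈F G → F ⊆Var G
≈F⇒⊆Var F≈G v (C , C∈ , l , l∈ , refl) with find (proj₁ (F≈G C) (lose C∈ ≈C-refl))
... | D , D∈ , C≈D = D , D∈ , l , proj₁ (C≈D l) l∈ , refl

variables : Formula → List ℕ
variables = concatMap (map var)

∈variables⁺ : ∀ F {v} → v ∈Var F → v ∈ variables F
∈variables⁺ F (C , C∈ , l , l∈ , refl) = ∈-concatMap⁺ (map var) (lose C∈ (∈-map⁺ var l∈))

∈variables⁻ : ∀ F {v} → v ∈ variables F → v ∈Var F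
∈variables⁻ F v∈ with find (∈-concatMap⁻ (map var) {xs = F} v∈)
... | C , C∈ , v∈C with ∈-map⁻ var v∈C
... | l , l∈ , refl = C , C∈ , l , l∈ , refl

∈Lit? : ∀ F → Decidable (_∈Lit F)
∈Lit? F l = map′ (∈variables⁻ F) (∈variables⁺ F) (var l ∈? variables F)

module _ {φ : Lit → Lit} {H : Formula}
         (bar-comm : ∀ l → l ∈Lit H → bar (φ l) ≡ φ (bar l)) where

  ∈Lit-act⁺ : ∀ {l} → l ∈Lit H → φ l ∈Lit act φ H
  ∈Lit-act⁺ {l} l∈@(C , C∈ , k , k∈ , k~l) =
    actC φ C , ∈-map⁺ (actC φ) C∈ , φ k , ∈-map⁺ φ k∈ , var-φ (var-injective-up-to-bar k l k~l)
    where
    var-φ : ∀ {k} → k ≡ l ⊎ k ≡ bar l → var (φ k) ≡ var (φ l)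
    var-φ (inj₁ refl) = refl
    var-φ (inj₂ refl) = trans (cong var (sym (bar-comm l l∈))) (var-bar (φ l))

  ∈Lit-act⁻ : ∀ {l} → l ∈Lit act φ H → Σ Lit λ l' → l' ∈Lit H × φ l' ≡ l
  ∈Lit-act⁻ {l} (C , C∈ , k , k∈ , k~l) with ∈-map⁻ (actC φ) C∈
  ... | D , D∈ , refl with ∈-map⁻ φ k∈
  ... | k' , k'∈ , refl with var-injective-up-to-bar (φ k') l k~l
  ... | inj₁ φk'≡l = k' , k'∈H , φk'≡l
    where k'∈H = D , D∈ , k' , k'∈ , refl
  ... | inj₂ φk'≡l̄ = bar k' , ∈Lit-bar k' k'∈H , (begin
    φ (bar k')      ≡⟨ bar-comm k' k'∈H ⟨
    bar (φ k')      ≡⟨ cong bar φk'≡l̄ ⟩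
    bar (bar l)     ≡⟨ bar-involutive l ⟩
    l               ∎)
    where
    open ≡-Reasoning
    k'∈H = D , D∈ , k' , k'∈ , refl

IsSymOn-cong : ∀ {P Q φ} → P ≐ Q → IsSymOn P φ → IsSymOn Q φ
IsSymOn-cong (P⊆Q , Q⊆P) (into , injective , onto , bar-comm) =
  (λ l → P⊆Q ∘ into l ∘ Q⊆P) ,
  (λ l₁ l₂ l₁∈ l₂∈ → injective l₁ l₂ (Q⊆P l₁∈) (Q⊆P l₂∈)) ,
  (λ l l∈ → let l' , l'∈ , φl'≡l = onto l (Q⊆P l∈) in l' , P⊆Q l'∈ , φl'≡l) ,
  (λ l → bar-comm l ∘ Q⊆P)

IsSymOn-restrict : ∀ {φ F H} → IsSymOn (_∈Lit F) φ → H ⊆Var F → H ≈F act φ H →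
                   StabilizesLit H φ × IsSynSym H φ
IsSymOn-restrict {φ} {F} {H} (_ , injective , _ , bar-comm) H⊆F H≈φH =
  (into , onto) , (into , injective-H , onto , bar-comm-H) , ≈F-sym H≈φH
  where
  bar-comm-H : ∀ l → l ∈Lit H → bar (φ l) ≡ φ (bar l)
  bar-comm-H l = bar-comm l ∘ H⊆F (var l)
  into : ∀ l → l ∈Lit H → φ l ∈Lit H
  into l = ≈F⇒⊆Var (≈F-sym H≈φH) _ ∘ ∈Lit-act⁺ bar-comm-H
  onto : ∀ l → l ∈Lit H → Σ Lit λ l' → l' ∈Lit H × φ l' ≡ l
  onto l = ∈Lit-act⁻ bar-comm-H ∘ ≈F⇒⊆Var H≈φH (var l)
  injective-H : ∀ l₁ l₂ → l₁ ∈Lit H → l₂ ∈Lit H → φ l₁ ≡ φ l₂ → l₁ ≡ l₂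
  injective-H l₁ l₂ l₁∈ l₂∈ = injective l₁ l₂ (H⊆F _ l₁∈) (H⊆F _ l₂∈)

act-⊆Var : ∀ {φ F G} → IsSymOn (_∈Lit F) φ → G ⊆Var F → act φ G ⊆Var F
act-⊆Var (into , _ , _ , bar-comm) G⊆F v v∈
  with ∈Lit-act⁻ (λ l → bar-comm l ∘ G⊆F (var l)) {pos v} v∈
... | l' , l'∈ , φl'≡v = subst (_∈Lit _) φl'≡v (into l' (G⊆F _ l'∈))

module Inverse {L : Lit → Set} (L? : Decidable L) (L-bar : ∀ {l} → L l → L (bar l))
               {φ : Lit → Lit} (φ-sym : IsSymOn L φ) where

  private
    into = proj₁ φ-sym
    injective = proj₁ (proj₂ φ-sym)
    onto = proj₁ (proj₂ (proj₂ φ-sym))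
    bar-comm = proj₂ (proj₂ (proj₂ φ-sym))

  inverse : Lit → Lit
  inverse l with L? l
  ... | yes l∈ = proj₁ (onto l l∈)
  ... | no _ = l

  inverse-right : ∀ {l} → L l → L (inverse l) × φ (inverse l) ≡ l
  inverse-right {l} l∈ with L? l
  ... | yes l∈′ = proj₂ (onto l l∈′)
  ... | no l∉ = contradiction l∈ l∉

  inverse-left : ∀ {l} → L l → inverse (φ l) ≡ l
  inverse-left {l} l∈ = let ψφl∈ , φψφl≡φl = inverse-right (into l l∈) in
    injective _ _ ψφl∈ l∈ φψφl≡φl

  inverse-isSym : IsSymOn L inverse
  inverse-isSym =
    (λ l → proj₁ ∘ inverse-right) ,
    (λ l₁ l₂ l₁∈ l₂∈ ψl₁≡ψl₂ → begin
      l₁                  ≡⟨ proj₂ (inverse-right l₁∈) ⟨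
      φ (inverse l₁)      ≡⟨ cong φ ψl₁≡ψl₂ ⟩
      φ (inverse l₂)      ≡⟨ proj₂ (inverse-right l₂∈) ⟩
      l₂                  ∎) ,
    (λ l l∈ → φ l , into l l∈ , inverse-left l∈) ,
    inverse-bar-comm
    where
    open ≡-Reasoning
    inverse-bar-comm : ∀ l → L l → bar (inverse l) ≡ inverse (bar l)
    inverse-bar-comm l l∈ = injective _ _ (L-bar ψl∈) (proj₁ (inverse-right (L-bar l∈))) (begin
      φ (bar (inverse l))   ≡⟨ bar-comm _ ψl∈ ⟨
      bar (φ (inverse l))   ≡⟨ cong bar φψl≡l ⟩
      bar l                 ≡⟨ proj₂ (inverse-right (L-bar l∈)) ⟨
      φ (inverse (bar l))   ∎)
      where ψl∈ = proj₁ (inverse-right l∈); φψl≡l = proj₂ (inverse-right l∈)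

no-member⇒[] : ∀ Hs → (∀ H → ¬ H ∈FS Hs) → Hs ≡ []
no-member⇒[] [] _ = refl
no-member⇒[] (H ∷ _) ∉Hs = ⊥-elim (∉Hs H (here ≈F-refl))

module _ (T : Transformation) where

  Step-congˡ : ∀ {F F' G} → F ≈F F' → Step T F' G → Step T F G
  Step-congˡ {F} {F'} {G} F≈F' = proj₂ (resp T F F' F≈F' G)

  normal-congˡ : ∀ {F F'} → F ≈F F' → Π T F' ≡ [] → Π T F ≡ []
  normal-congˡ F≈F' normal =
    no-member⇒[] _ λ H → ¬Any[] ∘ subst (H ∈FS_) normal ∘ Step-congˡ (≈F-sym F≈F')

  Star-⊆Var : ∀ {F G} → Star (Step T) F G → G ⊆Var F
  Star-⊆Var ε v v∈ = v∈
  Star-⊆Var (s ◅ ss) v v∈ = vars T _ _ s v (Star-⊆Var ss v v∈)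

  Exhaust-⊆Var : ∀ {F F*} → Exhaust T F F* → F* ⊆Var F
  Exhaust-⊆Var (_ , F→G , G≈F* , _) v = Star-⊆Var F→G v ∘ ≈F⇒⊆Var (≈F-sym G≈F*) v

  Exhaust-congˡ : ∀ {F F' F*} → F ≈F F' → Exhaust T F' F* → Exhaust T F F*
  Exhaust-congˡ F≈F' (_ , ε , F'≈F* , normal) =
    _ , ε , ≈F-trans F≈F' F'≈F* , normal-congˡ F≈F' normal
  Exhaust-congˡ F≈F' (G , s ◅ ss , G≈F* , normal) = G , Step-congˡ F≈F' s ◅ ss , G≈F* , normal

  module _ (iso : IsomorphismInvariant T) where

    -- With V = Var(F), the set Lit(A) ∪ V ∪ V̄ of the invariance condition is just Lit(F).
    Step-act : ∀ {φ F A B} → IsSymOn (_∈Lit F) φ → A ⊆Var F →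
               Step T A B → Step T (act φ A) (act φ B)
    Step-act {φ} {F} {A} φ-sym A⊆F = iso A (variables F) φ (IsSymOn-cong Lit-F≐ φ-sym) _
      where
      Lit-F≐ : (_∈Lit F) ≐ (λ l → l ∈Lit A ⊎ var l ∈ variables F)
      Lit-F≐ = inj₂ ∘ ∈variables⁺ F , [ A⊆F _ , ∈variables⁻ F ]′

    Star-act : ∀ {φ F A B} → IsSymOn (_∈Lit F) φ → A ⊆Var F →
               Star (Step T) A B → Star (Step T) (act φ A) (act φ B)
    Star-act φ-sym A⊆F ε = ε
    Star-act φ-sym A⊆F (s ◅ ss) =
      Step-act φ-sym A⊆F s ◅ Star-act φ-sym (λ v → A⊆F v ∘ vars T _ _ s v) ss

    -- A step from φ(G) would be carried by φ⁻¹ to a step from G.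
    normal-act : ∀ {φ F G} → IsSymOn (_∈Lit F) φ → G ⊆Var F →
                 Π T G ≡ [] → Π T (act φ G) ≡ []
    normal-act {φ} {F} {G} φ-sym G⊆F normal = no-member⇒[] _ λ H φG→H →
      ¬Any[] (subst (act inverse H ∈FS_) normal (subst (λ K → Step T K (act inverse H)) ψφG≡G
        (Step-act inverse-isSym (act-⊆Var φ-sym G⊆F) φG→H)))
      where
      open Inverse (∈Lit? F) (λ {l} → ∈Lit-bar l) φ-sym
      ψφG≡G : act inverse (act φ G) ≡ G
      ψφG≡G = act-inverse inverse φ G (λ l → inverse-left ∘ G⊆F (var l))

    Exhaust-act : ∀ {φ F F*} → IsSynSym F φ → Exhaust T F F* → Exhaust T F (act φ F*)
    Exhaust-act {φ} (φ-sym , φF≈F) (G , F→G , G≈F* , normal) = Exhaust-congˡ (≈F-sym φF≈F)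
      (act φ G , Star-act φ-sym (λ _ v∈ → v∈) F→G , act-cong φ G≈F* ,
       normal-act φ-sym (Star-⊆Var F→G) normal)

lemma2 : (T : Transformation) → Terminating T → Confluent T →
         IsomorphismInvariant T → SymmetryPreserving (Exhaust T)
lemma2 T _ confluent iso F F* F→F* φ φ-synSym =
  IsSymOn-restrict (proj₁ φ-synSym) (Exhaust-⊆Var T F→F*)
    (confluent F F* (act φ F*) F→F* (Exhaust-act T iso φ-synSym F→F*))
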